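{- Let $(Y,\le_Y)$ be a lattice. Then for every poset $(X,\le_X)$ and every finite $A\subseteq X$, every isotone map $f\colon A\to Y$ has an isotone extension $g\colon X\to Y$ (isotone with $g|_A=f$).
   Context: A lattice is a poset in which every finite nonempty subset has a supremum and an infimum. A map is isotone if $x\le y$ implies $f(x)\le f(y)$; $A$ carries the order induced from $X$. -}

module Defs where

open import Level using (Level; _⊔_)
open import Data.Nat using (ℕ)
open import Data.Fin using (Fin)
open import Data.Product using (Σ; _×_)
open import Relation.Binary.Bundles using (Poset)
open import Relation.Binary.Lattice.Bundles using (Lattice)

-- A finite subset A ⊆ X is given by an enumeration a : Fin n → X
-- (A = image of a).  A map f : A → Y is given on indices, f : Fin n → Y.
-- f is isotone w.r.t. the order on A induced from X.
IsotoneOnFinite : ∀ {a ℓa ℓa' c ℓ₁ ℓ₂} (X : Poset a ℓa ℓa') (Y : Lattice c ℓ₁ ℓ₂)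
                  {n : ℕ} → (Fin n → Poset.Carrier X) → (Fin n → Lattice.Carrier Y) → Set (ℓa' ⊔ ℓ₂)
IsotoneOnFinite X Y {n} a f =
  ∀ (i j : Fin n) → Poset._≤_ X (a i) (a j) → Lattice._≤_ Y (f i) (f j)

Isotone : ∀ {a ℓa ℓa' c ℓ₁ ℓ₂} (X : Poset a ℓa ℓa') (Y : Lattice c ℓ₁ ℓ₂)
          → (Poset.Carrier X → Lattice.Carrier Y) → Set (a ⊔ ℓa' ⊔ ℓ₂)
Isotone X Y g = ∀ {x y} → Poset._≤_ X x y → Lattice._≤_ Y (g x) (g y)

IsIsotoneExtension : ∀ {a ℓa ℓa' c ℓ₁ ℓ₂} (X : Poset a ℓa ℓa') (Y : Lattice c ℓ₁ ℓ₂)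
                     {n : ℕ} → (Fin n → Poset.Carrier X) → (Fin n → Lattice.Carrier Y)
                     → (Poset.Carrier X → Lattice.Carrier Y) → Set (a ⊔ ℓa' ⊔ ℓ₁ ⊔ ℓ₂)
IsIsotoneExtension X Y {n} a f g =
  Isotone X Y g × (∀ (i : Fin n) → Lattice._≈_ Y (g (a i)) (f i))

-- If m is a lower bound of f, then g x := m ∨ ⋁ { f i | a i ≤ x } is isotone, since the
-- index set grows with x, and restricts to f on A: at x = a j the join contains f j, and
-- every other joinand is bounded by f j, by isotonicity of f or because it is m.  For the
-- lower bound take the meet of all f i (the given element of Y when A is empty).
-- Excluded middle decides which a i lie below x.
module Submission where

open import Defs
open import Level using (Level)
open import Function using (_∘_)
open import Data.Nat using (ℕ; zero; suc)
open import Data.Fin using (Fin; zero; suc)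
open import Data.Product using (Σ; _,_)
open import Data.Vec.Functional using (Vector; foldr; tail)
open import Relation.Binary.Bundles using (Poset)
open import Relation.Binary.Lattice.Bundles using (Lattice; JoinSemilattice; MeetSemilattice)
open import Axiom.ExcludedMiddle using (ExcludedMiddle)
open import Relation.Nullary using (yes; no; contradiction)

module FiniteJoin {c ℓ₁ ℓ₂} (J : JoinSemilattice c ℓ₁ ℓ₂) where
  open JoinSemilattice J
  open import Relation.Binary.Lattice.Properties.JoinSemilattice J using (∨-monotonic)

  ⋁ : Carrier → ∀ {k} → Vector Carrier k → Carrier
  ⋁ b = foldr _∨_ b

  ≤⋁ : ∀ b {k} (h : Vector Carrier k) i → h i ≤ ⋁ b h
  ≤⋁ b h zero    = x≤x∨y _ _
  ≤⋁ b h (suc i) = trans (≤⋁ b (tail h) i) (y≤x∨y _ _)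

  ⋁-least : ∀ {b u k} {h : Vector Carrier k} → b ≤ u → (∀ i → h i ≤ u) → ⋁ b h ≤ u
  ⋁-least {k = zero}  b≤u h≤u = b≤u
  ⋁-least {k = suc k} b≤u h≤u = ∨-least (h≤u zero) (⋁-least b≤u (h≤u ∘ suc))

  ⋁-mono : ∀ b {k} {h h′ : Vector Carrier k} → (∀ i → h i ≤ h′ i) → ⋁ b h ≤ ⋁ b h′
  ⋁-mono b {zero}  h≤h′ = refl
  ⋁-mono b {suc k} h≤h′ = ∨-monotonic (h≤h′ zero) (⋁-mono b (h≤h′ ∘ suc))

module FiniteMeet {c ℓ₁ ℓ₂} (M : MeetSemilattice c ℓ₁ ℓ₂) where
  open MeetSemilattice M

  ⋀ : Carrier → ∀ {k} → Vector Carrier k → Carrier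
  ⋀ b = foldr _∧_ b

  ⋀≤ : ∀ b {k} (h : Vector Carrier k) i → ⋀ b h ≤ h i
  ⋀≤ b h zero    = x∧y≤x _ _
  ⋀≤ b h (suc i) = trans (x∧y≤y _ _) (⋀≤ b (tail h) i)

module ExtensionAbove {c ℓ₁ ℓ₂ a ℓa ℓa′ : Level}
  (Y : Lattice c ℓ₁ ℓ₂) (em : ExcludedMiddle ℓa′) (X : Poset a ℓa ℓa′)
  {n : ℕ} (as : Fin n → Poset.Carrier X) (f : Fin n → Lattice.Carrier Y)
  (m : Lattice.Carrier Y) (m≤f : ∀ i → Lattice._≤_ Y m (f i)) where

  module X = Poset X
  open Lattice Y using (_≤_; refl; trans; antisym; joinSemilattice)
  open FiniteJoin joinSemilattice using (⋁; ≤⋁; ⋁-least; ⋁-mono)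

  step : Fin n → X.Carrier → Lattice.Carrier Y
  step i x with em {as i X.≤ x}
  ... | yes _ = f i
  ... | no  _ = m

  step-mono : ∀ i {x y} → x X.≤ y → step i x ≤ step i y
  step-mono i {x} {y} x≤y with em {as i X.≤ x} | em {as i X.≤ y}
  ... | yes _    | yes _    = refl
  ... | yes aᵢ≤x | no  aᵢ≰y = contradiction (X.trans aᵢ≤x x≤y) aᵢ≰y
  ... | no  _    | yes _    = m≤f i
  ... | no  _    | no  _    = refl

  step-≤-at : IsotoneOnFinite X Y as f → ∀ i j → step i (as j) ≤ f j
  step-≤-at iso i j with em {as i X.≤ as j}
  ... | yes aᵢ≤aⱼ = iso i j aᵢ≤aⱼ
  ... | no  _     = m≤f j

  ≤-step-self : ∀ j → f j ≤ step j (as j)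
  ≤-step-self j with em {as j X.≤ as j}
  ... | yes _     = refl
  ... | no  aⱼ≰aⱼ = contradiction X.refl aⱼ≰aⱼ

  extension : X.Carrier → Lattice.Carrier Y
  extension x = ⋁ m (λ i → step i x)

  extension-isIsotoneExtension : IsotoneOnFinite X Y as f → IsIsotoneExtension X Y as f extension
  extension-isIsotoneExtension iso =
      (λ x≤y → ⋁-mono m (λ i → step-mono i x≤y))
    , (λ j → antisym (⋁-least (m≤f j) (λ i → step-≤-at iso i j))
                     (trans (≤-step-self j) (≤⋁ m _ j)))

corollary2p14 : ∀ {c ℓ₁ ℓ₂ : Level} (Y : Lattice c ℓ₁ ℓ₂) → Lattice.Carrier Y
                → ∀ {a ℓa ℓa' : Level} → ExcludedMiddle ℓa' → (X : Poset a ℓa ℓa')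
                → (n : ℕ) (as : Fin n → Poset.Carrier X) (f : Fin n → Lattice.Carrier Y)
                → IsotoneOnFinite X Y as f
                → Σ (Poset.Carrier X → Lattice.Carrier Y) (λ g → IsIsotoneExtension X Y as f g)
corollary2p14 Y y₀ em X n as f iso = extension , extension-isIsotoneExtension iso
  where
  open FiniteMeet (Lattice.meetSemilattice Y) using (⋀; ⋀≤)
  open ExtensionAbove Y em X as f (⋀ y₀ f) (⋀≤ y₀ f)
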